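{- Let $(X,d)$ be a metric space with fixed doubling constant $D$, let $\epsilon>0$ be fixed, let $k\ge1$ be an integer, and let $S_1,\ldots,S_L\subseteq X$ be finite sets of points. For each $i$, let $r_i$ be the radius of a $k$-center solution of $S_i$ computed by a $k$-center algorithm (i.e. $r_i=\max_{p\in S_i}\min_{c\in C_i}d(p,c)$ for some $C_i\subseteq S_i$ with $|C_i|\le k$). Let $G_i$ be the disk graph of $S_i$ with radius $\epsilon r_i/2$ (vertex set $S_i$, distinct points adjacent iff their distance is at most $2\cdot \epsilon r_i/2=\epsilon r_i$), let $G_i^2$ be its square (distinct vertices adjacent iff adjacent in $G_i$ or having a common neighbor in $G_i$), and let $C(S_i)$ be any maximal independent set of $G_i^2$. Then the coreset $\bigcup_{i=1}^L C(S_i)$ has size $O(kL)$, where the constant hidden in the $O$ depends only on $\epsilon$ and $D$.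
   Context: The doubling constant $D$ of $(X,d)$ is such that for every $x\in X$ and every $\rho\ge 0$, the closed ball of radius $2\rho$ centered at $x$ can be covered by at most $D$ closed balls of radius $\rho$ (centered at points of $X$); the doubling dimension is $\log_2 D$. The metric $k$-center problem on a set $S$: choose at most $k$ centers $C\subseteq S$ minimizing $\max_{p\in S}\min_{c\in C}d(p,c)$. The sets $S_1,\dots,S_L$ are an arbitrary partition/collection of the input, each processed independently. -}

module Defs where

open import Data.Nat as ℕ using (ℕ; zero; suc)
open import Data.Fin using (Fin)
open import Data.List using (List; length)
open import Data.List.Membership.Propositional using (_∈_; _∉_)
open import Data.List.Relation.Unary.Unique.Propositional using (Unique)
open import Data.Product using (Σ; ∃; ∃-syntax; _×_)
open import Data.Sum using (_⊎_)
open import Relation.Binary.PropositionalEquality using (_≡_; _≢_)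
open import Relation.Nullary using (¬_)
open import Algebra.Structures using (IsCommutativeRing)

-- Archimedean ordered fields (the codomain of the metric).
-- Every Archimedean ordered field embeds into ℝ as an ordered field and
-- ℝ is one, so quantifying over them is equivalent to using ℝ.

natEmb : {A : Set} → (A → A → A) → A → A → ℕ → A
natEmb _+_ 0# 1# zero    = 0#
natEmb _+_ 0# 1# (suc n) = 1# + natEmb _+_ 0# 1# n

record ArchOrderedField : Set₁ where
  infixl 6 _+_
  infixl 7 _*_
  infix 4 _≤_
  field
    Carrier : Set
    _+_ _*_ : Carrier → Carrier → Carrier
    -_      : Carrier → Carrier
    0# 1#   : Carrier
    isCommutativeRing : IsCommutativeRing _≡_ _+_ _*_ -_ 0# 1#
    0≢1     : 0# ≢ 1#
    inverse : ∀ x → x ≢ 0# → ∃[ y ] (x * y ≡ 1#)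
    _≤_       : Carrier → Carrier → Set
    ≤-refl    : ∀ {x} → x ≤ x
    ≤-trans   : ∀ {x y z} → x ≤ y → y ≤ z → x ≤ z
    ≤-antisym : ∀ {x y} → x ≤ y → y ≤ x → x ≡ y
    ≤-total   : ∀ x y → x ≤ y ⊎ y ≤ x
    +-mono-≤  : ∀ {x y} z → x ≤ y → x + z ≤ y + z
    *-nonneg  : ∀ {x y} → 0# ≤ x → 0# ≤ y → 0# ≤ x * y
    archimedean : ∀ x → ∃[ n ] (x ≤ natEmb _+_ 0# 1# n)

  _<_ : Carrier → Carrier → Set
  x < y = x ≤ y × x ≢ y

module _ (F : ArchOrderedField) where
  open ArchOrderedField F

  record MetricSpace : Set₁ where
    field
      Point    : Set
      d        : Point → Point → Carrier
      d-nonneg : ∀ x y → 0# ≤ d x y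
      d-zero   : ∀ x y → d x y ≡ 0# → x ≡ y
      d-refl   : ∀ x → d x x ≡ 0#
      d-sym    : ∀ x y → d x y ≡ d y x
      d-tri    : ∀ x y z → d x z ≤ d x y + d y z

  module _ (M : MetricSpace) where
    open MetricSpace M

    Doubling : ℕ → Set
    Doubling D = ∀ (x : Point) (ρ : Carrier) → 0# ≤ ρ →
      Σ (List Point) λ cs → (length cs ℕ.≤ D) ×
        (∀ y → d x y ≤ ρ + ρ → Σ Point λ c → (c ∈ cs) × (d c y ≤ ρ))

    -- C ⊆ S, |C| ≤ k, and r = max_{p∈S} min_{c∈C} d(p,c)
    -- (S is taken nonempty for the max to be attained; for S empty r is unconstrained)
    KCenterSolution : ℕ → List Point → List Point → Carrier → Set
    KCenterSolution k S C r =
      (∀ {c} → c ∈ C → c ∈ S) × (length C ℕ.≤ k) ×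
      (∀ {p} → p ∈ S → Σ Point λ c → (c ∈ C) × (d p c ≤ r)) ×
      (∀ {q} → q ∈ S → Σ Point λ p → (p ∈ S) × (∀ {c} → c ∈ C → r ≤ d p c))

    -- disk graph of S with radius δ/2: distinct points adjacent iff distance ≤ δ
    DiskAdj : Carrier → Point → Point → Set
    DiskAdj δ p q = p ≢ q × d p q ≤ δ

    SqAdj : List Point → Carrier → Point → Point → Set
    SqAdj S δ p q = p ≢ q ×
      (DiskAdj δ p q ⊎ Σ Point λ w → (w ∈ S) × DiskAdj δ p w × DiskAdj δ w q)

    MaxIndepSq : List Point → Carrier → List Point → Set
    MaxIndepSq S δ I =
      Unique I × (∀ {p} → p ∈ I → p ∈ S) ×
      (∀ {p q} → p ∈ I → q ∈ I → ¬ SqAdj S δ p q) ×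
      (∀ {p} → p ∈ S → p ∉ I → Σ Point λ q → (q ∈ I) × SqAdj S δ p q)

-- Fix ε > 0 and choose, by the Archimedean property, N with 1 ≤ 2ᴺ·ε.  Let
-- ρ = εr/2 for a cluster S with k-center solution C of radius r.  Then:
--   * distinct points of an independent set I of G² are more than 2ρ = εr
--     apart, since points at distance ≤ εr are already adjacent in G;
--   * every point of S lies within r ≤ 2ᴺ·εr = 2ᴺ⁺¹·ρ of a center, and by
--     iterating the doubling property each ball of radius 2ᴺ⁺¹·ρ is covered
--     by D^(N+1) balls of radius ρ, so the k centers give k·D^(N+1) small balls;
--   * a small ball contains at most one point of I (packing), hence
--     |I| ≤ D^(N+1)·k.
-- Summing over the L clusters bounds the (duplicate-free) union by D^(N+1)·k·L,
-- and the constant D^(N+1) depends only on ε and D.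

module Submission where

open import Defs
open import Data.Nat using (ℕ; _*_; _≤_)
open import Data.Fin using (Fin)
open import Data.List using (List; length)
open import Data.List.Membership.Propositional using (_∈_)
open import Data.List.Relation.Unary.Unique.Propositional using (Unique)
open import Data.Product using (Σ; ∃; ∃-syntax; _×_)
open import Function.Bundles using (_⇔_)

open import Data.Nat using (zero; suc; _^_; z≤n; s≤s; _≤?_)
open import Data.Nat.Properties as ℕ using (≰⇒>)
open import Data.Fin as Fin using (zero; suc)
open import Data.Fin.Properties using (pigeonhole)
open import Data.List using ([]; _∷_; [_]; lookup; concatMap; allFin)
open import Data.List.Properties using (length-++; length-tabulate)
open import Data.List.Membership.Propositional using (lose)
open import Data.List.Membership.Propositional.Properties
  using (∈-lookup; ∈-allFin; ∈-concatMap⁺)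
open import Data.List.Relation.Unary.Any as Any using (here; there)
open import Data.List.Relation.Unary.Any.Properties using (lookup-index)
open import Data.List.Relation.Unary.All as All using ()
open import Data.List.Relation.Unary.AllPairs using (_∷_)
open import Data.Product using (_,_; proj₁; proj₂)
open import Data.Sum using (inj₁; inj₂)
open import Data.Empty using (⊥; ⊥-elim)
open import Relation.Nullary using (yes; no; ¬_)
open import Relation.Binary.PropositionalEquality
  using (_≡_; _≢_; refl; sym; trans; cong; cong₂; subst; subst₂; module ≡-Reasoning)
open import Function.Bundles using (Equivalence)
open import Algebra.Bundles using (Ring)
open import Algebra.Structures using (IsCommutativeRing)

module _ {A B : Set} where

  lookup-distinct : {xs : List A} → Unique xs → {i j : Fin (length xs)} →
    i Fin.< j → lookup xs i ≢ lookup xs j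
  lookup-distinct {x ∷ xs} (x∉xs ∷ _) {zero} {suc j} _ =
    All.lookup x∉xs (∈-lookup {xs = xs} j)
  lookup-distinct {x ∷ xs} (_ ∷ unique) {suc i} {suc j} (s≤s i<j) =
    lookup-distinct unique i<j

  length-≤-by-relation : (R : A → B → Set) {U : List A} (W : List B) → Unique U →
    (∀ {x} → x ∈ U → Σ B λ b → b ∈ W × R x b) →
    (∀ {x y b} → x ∈ U → y ∈ U → R x b → R y b → x ≢ y → ⊥) →
    length U ≤ length W
  length-≤-by-relation R {U} W unique witness single-fibre
    with length U ≤? length W
  ... | yes U≤W = U≤W
  ... | no U≰W = ⊥-elim (collision (pigeonhole (≰⇒> U≰W) slot))
    where
    target∈W : (i : Fin (length U)) → proj₁ (witness (∈-lookup i)) ∈ W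
    target∈W i = proj₁ (proj₂ (witness (∈-lookup i)))
    relatedAt : (i : Fin (length U)) → R (lookup U i) (proj₁ (witness (∈-lookup i)))
    relatedAt i = proj₂ (proj₂ (witness (∈-lookup i)))
    slot : Fin (length U) → Fin (length W)
    slot i = Any.index (target∈W i)
    same-target : ∀ i j → slot i ≡ slot j →
      proj₁ (witness (∈-lookup j)) ≡ proj₁ (witness (∈-lookup i))
    same-target i j same-slot = begin
      proj₁ (witness (∈-lookup j)) ≡⟨ lookup-index (target∈W j) ⟩
      lookup W (slot j)            ≡⟨ cong (lookup W) (sym same-slot) ⟩
      lookup W (slot i)            ≡⟨ lookup-index (target∈W i) ⟨
      proj₁ (witness (∈-lookup i)) ∎
      where open ≡-Reasoning
    collision : (∃ λ i → ∃ λ j → i Fin.< j × slot i ≡ slot j) → ⊥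
    collision (i , j , i<j , same-slot) =
      single-fibre (∈-lookup i) (∈-lookup j)
        (relatedAt i) (subst (R (lookup U j)) (same-target i j same-slot) (relatedAt j))
        (lookup-distinct unique i<j)

  length-concatMap-≤ : (f : A → List B) (xs : List A) (m : ℕ) →
    (∀ {x} → x ∈ xs → length (f x) ≤ m) → length (concatMap f xs) ≤ m * length xs
  length-concatMap-≤ f [] m short = z≤n
  length-concatMap-≤ f (x ∷ xs) m short
    rewrite length-++ (f x) {concatMap f xs} | ℕ.*-suc m (length xs) =
    ℕ.+-mono-≤ (short (here refl)) (length-concatMap-≤ f xs m (λ x∈ → short (there x∈)))

  ∈-concatMap-intro : (f : A → List B) {xs : List A} {a : A} {y : B} →
    y ∈ f a → a ∈ xs → y ∈ concatMap f xs
  ∈-concatMap-intro f y∈fa a∈xs = ∈-concatMap⁺ f (lose a∈xs y∈fa)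

union-length-≤ : {A : Set} {L : ℕ} (I : Fin L → List A) (m : ℕ) →
  (∀ i → length (I i) ≤ m) → (U : List A) → Unique U →
  (∀ x → (x ∈ U) ⇔ Σ (Fin L) λ i → x ∈ I i) → length U ≤ m * L
union-length-≤ {L = L} I m short U unique U≡⋃I = ℕ.≤-trans U≤⋃I ⋃I≤mL
  where
  ⋃I : List _
  ⋃I = concatMap I (allFin L)
  U≤⋃I : length U ≤ length ⋃I
  U≤⋃I = length-≤-by-relation _≡_ ⋃I unique
    (λ {x} x∈U → let (i , x∈Ii) = Equivalence.to (U≡⋃I x) x∈U
                 in x , ∈-concatMap-intro I x∈Ii (∈-allFin i) , refl)
    (λ _ _ x≡b y≡b x≢y → x≢y (trans x≡b (sym y≡b)))
  ⋃I≤mL : length ⋃I ≤ m * L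
  ⋃I≤mL = subst (λ n → length ⋃I ≤ m * n) (length-tabulate (λ i → i))
            (length-concatMap-≤ I (allFin L) m (λ {i} _ → short i))

module OrderedField (F : ArchOrderedField) where
  open ArchOrderedField F renaming (_≤_ to _≤F_; _*_ to _*F_)
  open IsCommutativeRing isCommutativeRing using (isRing; *-comm)

  ring : Ring _ _
  ring = record { isRing = isRing }

  open Ring ring using (+-identityˡ; +-identityʳ; +-assoc; +-comm; -‿inverseˡ;
    -‿inverseʳ; *-identityˡ; *-identityʳ; distribˡ; distribʳ; zeroˡ)
  open import Algebra.Properties.Ring ring using (-1*x≈-x; x[y-z]≈xy-xz; -‿involutive)
  open ≡-Reasoning

  +-monoʳ-≤ : ∀ {x y} z → x ≤F y → z + x ≤F z + y
  +-monoʳ-≤ {x} {y} z x≤y = subst₂ _≤F_ (+-comm x z) (+-comm y z) (+-mono-≤ z x≤y)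

  +-mono₂-≤ : ∀ {a b x y} → a ≤F b → x ≤F y → a + x ≤F b + y
  +-mono₂-≤ {b = b} {x} a≤b x≤y = ≤-trans (+-mono-≤ x a≤b) (+-monoʳ-≤ b x≤y)

  diff-nonneg : ∀ {x y} → x ≤F y → 0# ≤F y + - x
  diff-nonneg {x} {y} x≤y = subst (_≤F y + - x) (-‿inverseʳ x) (+-mono-≤ (- x) x≤y)

  diff-nonneg⁻ : ∀ {x y} → 0# ≤F y + - x → x ≤F y
  diff-nonneg⁻ {x} {y} 0≤y-x = subst₂ _≤F_ (+-identityˡ x) cancel (+-mono-≤ x 0≤y-x)
    where
    cancel : (y + - x) + x ≡ y
    cancel = begin
      (y + - x) + x ≡⟨ +-assoc y (- x) x ⟩
      y + (- x + x) ≡⟨ cong (y +_) (-‿inverseˡ x) ⟩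
      y + 0#        ≡⟨ +-identityʳ y ⟩
      y             ∎

  *-monoˡ-≤ : ∀ {a x y} → 0# ≤F a → x ≤F y → a *F x ≤F a *F y
  *-monoˡ-≤ {a} {x} {y} 0≤a x≤y =
    diff-nonneg⁻ (subst (0# ≤F_) (x[y-z]≈xy-xz a y x) (*-nonneg 0≤a (diff-nonneg x≤y)))

  *-monoʳ-≤ : ∀ {a x y} → 0# ≤F a → x ≤F y → x *F a ≤F y *F a
  *-monoʳ-≤ {a} {x} {y} 0≤a x≤y = subst₂ _≤F_ (*-comm a x) (*-comm a y) (*-monoˡ-≤ 0≤a x≤y)

  ≤-*-factor≥1 : ∀ {a x} → 0# ≤F x → 1# ≤F a → x ≤F a *F x
  ≤-*-factor≥1 {a} {x} 0≤x 1≤a = subst (_≤F a *F x) (*-identityˡ x) (*-monoʳ-≤ 0≤x 1≤a)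

  x≤x+x : ∀ {x} → 0# ≤F x → x ≤F x + x
  x≤x+x {x} 0≤x = subst (_≤F x + x) (+-identityˡ x) (+-mono-≤ x 0≤x)

  -- If 1 ≤ 0 then 0 ≤ -1, so 0 ≤ (-1)·(-1) = 1, contradicting 0 ≢ 1.
  0≤1 : 0# ≤F 1#
  0≤1 with ≤-total 0# 1#
  ... | inj₁ 0≤1 = 0≤1
  ... | inj₂ 1≤0 = subst (0# ≤F_) square (*-nonneg 0≤-1 0≤-1)
    where
    0≤-1 : 0# ≤F - 1#
    0≤-1 = subst₂ _≤F_ (-‿inverseʳ 1#) (+-identityˡ (- 1#)) (+-mono-≤ (- 1#) 1≤0)
    square : - 1# *F - 1# ≡ 1#
    square = trans (-1*x≈-x (- 1#)) (-‿involutive 1#)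

  1≰0 : ¬ (1# ≤F 0#)
  1≰0 1≤0 = 0≢1 (≤-antisym 0≤1 1≤0)

  2≢0 : 1# + 1# ≢ 0#
  2≢0 2≡0 = 1≰0 (subst (1# ≤F_) 2≡0 (x≤x+x 0≤1))

  half : Carrier
  half = proj₁ (inverse (1# + 1#) 2≢0)

  half+half : half + half ≡ 1#
  half+half = begin
    half + half             ≡⟨ sym (cong₂ _+_ (*-identityˡ half) (*-identityˡ half)) ⟩
    1# *F half + 1# *F half ≡⟨ sym (distribʳ half 1# 1#) ⟩
    (1# + 1#) *F half       ≡⟨ proj₂ (inverse (1# + 1#) 2≢0) ⟩
    1#                      ∎

  half-nonneg : 0# ≤F half
  half-nonneg with ≤-total 0# half
  ... | inj₁ 0≤half = 0≤half
  ... | inj₂ half≤0 =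
    ⊥-elim (1≰0 (subst₂ _≤F_ half+half (+-identityˡ 0#) (+-mono₂-≤ half≤0 half≤0)))

  2^_·_ : ℕ → Carrier → Carrier
  2^ zero · x  = x
  2^ suc j · x = 2^ j · x + 2^ j · x

  2^·-nonneg : ∀ j {x} → 0# ≤F x → 0# ≤F 2^ j · x
  2^·-nonneg zero    0≤x = 0≤x
  2^·-nonneg (suc j) 0≤x = ≤-trans (2^·-nonneg j 0≤x) (x≤x+x (2^·-nonneg j 0≤x))

  2^·-increasing : ∀ j {x} → 0# ≤F x → x ≤F 2^ j · x
  2^·-increasing zero    0≤x = ≤-refl
  2^·-increasing (suc j) 0≤x = ≤-trans (2^·-increasing j 0≤x) (x≤x+x (2^·-nonneg j 0≤x))

  2^·-*ʳ : ∀ j x y → 2^ j · (x *F y) ≡ (2^ j · x) *F y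
  2^·-*ʳ zero    x y = refl
  2^·-*ʳ (suc j) x y = trans (cong₂ _+_ (2^·-*ʳ j x y) (2^·-*ʳ j x y))
                             (sym (distribʳ y (2^ j · x) (2^ j · x)))

  2^·-half : ∀ j x → 2^ suc j · (x *F half) ≡ 2^ j · x
  2^·-half zero x = begin
    x *F half + x *F half ≡⟨ sym (distribˡ x half half) ⟩
    x *F (half + half)    ≡⟨ cong (x *F_) half+half ⟩
    x *F 1#               ≡⟨ *-identityʳ x ⟩
    x                     ∎
  2^·-half (suc j) x = cong₂ _+_ (2^·-half j x) (2^·-half j x)

  multiple≤2^· : ∀ n {ε} → 0# ≤F ε → natEmb _+_ 0# 1# n *F ε ≤F 2^ n · ε
  multiple≤2^· zero    {ε} 0≤ε = subst (_≤F ε) (sym (zeroˡ ε)) 0≤ε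
  multiple≤2^· (suc n) {ε} 0≤ε = subst (_≤F 2^ suc n · ε) (sym expand)
    (+-mono₂-≤ (2^·-increasing n 0≤ε) (multiple≤2^· n 0≤ε))
    where
    expand : (1# + natEmb _+_ 0# 1# n) *F ε ≡ ε + natEmb _+_ 0# 1# n *F ε
    expand = trans (distribʳ ε 1# _) (cong (_+ natEmb _+_ 0# 1# n *F ε) (*-identityˡ ε))

  -- Archimedean property in doubling form: for ε > 0 some 2ᴺ·ε is at least 1.
  -- Take n ≥ ε⁻¹; then 1 = ε·ε⁻¹ ≤ ε·n ≤ 2ⁿ·ε.
  archimedean-doubling : ∀ {ε} → 0# < ε → ∃[ N ] (1# ≤F 2^ N · ε)
  archimedean-doubling {ε} (0≤ε , 0≢ε) =
    n , ≤-trans (subst (_≤F ε *F natEmb _+_ 0# 1# n) ε·ε⁻¹≡1 (*-monoˡ-≤ 0≤ε ε⁻¹≤n))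
                (subst (_≤F 2^ n · ε) (*-comm _ ε) (multiple≤2^· n 0≤ε))
    where
    ε⁻¹ : Carrier
    ε⁻¹ = proj₁ (inverse ε (λ ε≡0 → 0≢ε (sym ε≡0)))
    ε·ε⁻¹≡1 : ε *F ε⁻¹ ≡ 1#
    ε·ε⁻¹≡1 = proj₂ (inverse ε (λ ε≡0 → 0≢ε (sym ε≡0)))
    n : ℕ
    n = proj₁ (archimedean ε⁻¹)
    ε⁻¹≤n : ε⁻¹ ≤F natEmb _+_ 0# 1# n
    ε⁻¹≤n = proj₂ (archimedean ε⁻¹)

module DoublingSpace (F : ArchOrderedField) (X : MetricSpace F)
                     (D : ℕ) (doubling : Doubling F X D) where
  open ArchOrderedField F renaming (_≤_ to _≤F_; _*_ to _*F_)
  open MetricSpace X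
  open OrderedField F

  iterated-cover : ∀ j (x : Point) {ρ} → 0# ≤F ρ →
    Σ (List Point) λ cs → (length cs ≤ D ^ j) ×
      (∀ y → d x y ≤F 2^ j · ρ → Σ Point λ c → (c ∈ cs) × (d c y ≤F ρ))
  iterated-cover zero    x 0≤ρ = [ x ] , s≤s z≤n , λ y dxy≤ρ → x , here refl , dxy≤ρ
  iterated-cover (suc j) x {ρ} 0≤ρ =
    concatMap finer coarse , length≤ , covers
    where
    coarse-cover = doubling x (2^ j · ρ) (2^·-nonneg j 0≤ρ)
    coarse : List Point
    coarse = proj₁ coarse-cover
    finer : Point → List Point
    finer c = proj₁ (iterated-cover j c 0≤ρ)
    length≤ : length (concatMap finer coarse) ≤ D ^ suc j
    length≤ = ℕ.≤-trans
      (length-concatMap-≤ finer coarse (D ^ j) (λ {c} _ → proj₁ (proj₂ (iterated-cover j c 0≤ρ))))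
      (subst (D ^ j * length coarse ≤_) (ℕ.*-comm (D ^ j) D)
        (ℕ.*-monoʳ-≤ (D ^ j) (proj₁ (proj₂ coarse-cover))))
    covers : ∀ y → d x y ≤F 2^ suc j · ρ → Σ Point λ c → (c ∈ concatMap finer coarse) × (d c y ≤F ρ)
    covers y dxy≤ with proj₂ (proj₂ coarse-cover) y dxy≤
    ... | c′ , c′∈coarse , dc′y≤ with proj₂ (proj₂ (iterated-cover j c′ 0≤ρ)) y dc′y≤
    ...   | c , c∈finer , dcy≤ρ = c , ∈-concatMap-intro finer c∈finer c′∈coarse , dcy≤ρ

  -- Packing: points that are pairwise more than 2ρ apart and all lie within
  -- 2ʲ·ρ of some point of C number at most Dʲ·|C|, because each of the Dʲ·|C|
  -- balls of radius ρ covering the neighbourhood of C contains at most one.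
  packing : ∀ j {ρ} → 0# ≤F ρ → (C P : List Point) → Unique P →
    (∀ {p} → p ∈ P → Σ Point λ c → (c ∈ C) × (d p c ≤F 2^ j · ρ)) →
    (∀ {p q} → p ∈ P → q ∈ P → p ≢ q → ¬ (d p q ≤F ρ + ρ)) →
    length P ≤ D ^ j * length C
  packing j {ρ} 0≤ρ C P unique near separated =
    ℕ.≤-trans (length-≤-by-relation (λ p c → d c p ≤F ρ) balls unique in-ball one-per-ball)
              (length-concatMap-≤ cover C (D ^ j) (λ {c} _ → proj₁ (proj₂ (iterated-cover j c 0≤ρ))))
    where
    cover : Point → List Point
    cover c = proj₁ (iterated-cover j c 0≤ρ)
    balls : List Point
    balls = concatMap cover C
    in-ball : ∀ {p} → p ∈ P → Σ Point λ b → (b ∈ balls) × (d b p ≤F ρ)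
    in-ball p∈P with near p∈P
    ... | c , c∈C , dpc≤ with proj₂ (proj₂ (iterated-cover j c 0≤ρ)) _ (subst (_≤F _) (d-sym _ c) dpc≤)
    ...   | b , b∈cover , dbp≤ρ = b , ∈-concatMap-intro cover b∈cover c∈C , dbp≤ρ
    one-per-ball : ∀ {p q b} → p ∈ P → q ∈ P → d b p ≤F ρ → d b q ≤F ρ → p ≢ q → ⊥
    one-per-ball {p} {q} {b} p∈P q∈P dbp≤ρ dbq≤ρ p≢q = separated p∈P q∈P p≢q
      (≤-trans (d-tri p b q) (+-mono₂-≤ (subst (_≤F ρ) (d-sym b p) dbp≤ρ) dbq≤ρ))

  independent-separated : ∀ {S δ I} → MaxIndepSq F X S δ I →
    ∀ {p q} → p ∈ I → q ∈ I → p ≢ q → ¬ (d p q ≤F δ)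
  independent-separated (_ , _ , independent , _) p∈I q∈I p≢q dpq≤δ =
    independent p∈I q∈I (p≢q , inj₁ (p≢q , dpq≤δ))

  cluster-bound : ∀ {ε} N → 0# ≤F ε → 1# ≤F 2^ N · ε → ∀ {k S C r I} →
    KCenterSolution F X k S C r → MaxIndepSq F X S (ε *F r) I →
    length I ≤ D ^ suc N * k
  cluster-bound N 0≤ε 1≤2ᴺε {I = []} _ _ = z≤n
  cluster-bound {ε} N 0≤ε 1≤2ᴺε {C = C} {r} {I@(p₀ ∷ _)}
    (_ , |C|≤k , assigned , _) mis@(unique , I⊆S , _) =
    ℕ.≤-trans (packing (suc N) 0≤ρ C I unique near separated)
              (ℕ.*-monoʳ-≤ (D ^ suc N) |C|≤k)
    where
    0≤r : 0# ≤F r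
    0≤r = ≤-trans (d-nonneg p₀ _) (proj₂ (proj₂ (assigned (I⊆S (here refl)))))
    ρ : Carrier
    ρ = (ε *F r) *F half
    0≤ρ : 0# ≤F ρ
    0≤ρ = *-nonneg (*-nonneg 0≤ε 0≤r) half-nonneg
    ρ+ρ≡εr : ρ + ρ ≡ ε *F r
    ρ+ρ≡εr = 2^·-half zero (ε *F r)
    -- r = 1·r ≤ (2ᴺ·ε)·r = 2ᴺ·(εr) = 2ᴺ⁺¹·ρ
    r≤2ᴺ⁺¹ρ : r ≤F 2^ suc N · ρ
    r≤2ᴺ⁺¹ρ = subst (r ≤F_) (sym (trans (2^·-half N (ε *F r)) (2^·-*ʳ N ε r)))
                (≤-*-factor≥1 0≤r 1≤2ᴺε)
    near : ∀ {p} → p ∈ I → Σ Point λ c → (c ∈ C) × (d p c ≤F 2^ suc N · ρ)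
    near p∈I with assigned (I⊆S p∈I)
    ... | c , c∈C , dpc≤r = c , c∈C , ≤-trans dpc≤r r≤2ᴺ⁺¹ρ
    separated : ∀ {p q} → p ∈ I → q ∈ I → p ≢ q → ¬ (d p q ≤F ρ + ρ)
    separated p∈I q∈I p≢q dpq≤ =
      independent-separated mis p∈I q∈I p≢q (subst (_ ≤F_) ρ+ρ≡εr dpq≤)

theorem5 : (F : ArchOrderedField) → (ε : ArchOrderedField.Carrier F) →
    ArchOrderedField._<_ F (ArchOrderedField.0# F) ε → (D : ℕ) →
    ∃[ c ] ((X : MetricSpace F) → Doubling F X D →
    (k : ℕ) → 1 ≤ k → (L : ℕ) →
    (S : Fin L → List (MetricSpace.Point X)) → (∀ i → Unique (S i)) →
    (r : Fin L → ArchOrderedField.Carrier F) →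
    (C : Fin L → List (MetricSpace.Point X)) →
    (∀ i → KCenterSolution F X k (S i) (C i) (r i)) →
    (I : Fin L → List (MetricSpace.Point X)) →
    (∀ i → MaxIndepSq F X (S i) (ArchOrderedField._*_ F ε (r i)) (I i)) →
    (U : List (MetricSpace.Point X)) → Unique U →
    (∀ x → (x ∈ U) ⇔ Σ (Fin L) λ i → x ∈ I i) →
    length U ≤ c * k * L)
theorem5 F ε 0<ε D with OrderedField.archimedean-doubling F 0<ε
... | N , 1≤2ᴺε = D ^ suc N ,
  λ X doubling k _ L S _ r C kc I mis U unique U≡⋃I →
    union-length-≤ I (D ^ suc N * k)
      (λ i → DoublingSpace.cluster-bound F X D doubling N (proj₁ 0<ε) 1≤2ᴺε (kc i) (mis i))
      U unique U≡⋃I
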